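{- Let $G$ be a bipartite graph with no universal vertex, let $B_0\in\mathcal{B}(G)$ and $v\in B_0$, and suppose $B_0-v\in\mathcal{B}(G-v)$. Then for every $B\in\mathcal{B}(G)$ such that $B-v\in\mathcal{B}(G-v)$: if $(B,B_0)$ is an arc of $\mathbf{H}(G)$ then $(B-v,B_0-v)$ is an arc of $\mathbf{H}(G-v)$; and if $(B_0,B)$ is an arc of $\mathbf{H}(G)$ then $(B_0-v,B-v)$ is an arc of $\mathbf{H}(G-v)$.
   Context: A universal vertex is a vertex adjacent to all vertices of the opposite color class. For a bipartite graph $G$ with color classes $X,Y$, a biclique is a pair $B=(U,W)$, $U\subseteq X$, $W\subseteq Y$, all of $U$ adjacent to all of $W$, with $X(B)=U$, $Y(B)=W$; $v\in B$ means $v\in X(B)\cup Y(B)$, and $B-v=(X(B)\setminus\{v\},Y(B)\setminus\{v\})$. $\mathcal{B}(G)$ is the set of maximal bicliques (not dominated by another biclique, where $B$ dominates $B'$ if $X(B')\subseteq X(B)$ and $Y(B')\subseteq Y(B)$), ordered by $B\preceq B'$ iff $X(B)\subseteq X(B')$. $\mathbf{H}(G)$ is the transitive reduction of $(\mathcal{B}(G),\preceq)$: the digraph on $\mathcal{B}(G)$ with an arc $(B,B')$ iff $B'$ covers $B$. $G-v$ is $G$ with $v$ deleted. -}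

module Defs where

open import Data.Nat using (ℕ)
open import Data.Fin using (Fin)
open import Data.Fin.Subset using (Subset; _∈_; _⊆_; ⊤; _-_)
open import Data.Product using (Σ; _×_; _,_; proj₁; proj₂)
open import Data.Sum using (_⊎_; inj₁; inj₂)
open import Relation.Nullary using (¬_)
open import Relation.Binary.PropositionalEquality using (_≡_; _≢_)
open import Level using (0ℓ; suc)

-- A finite bipartite graph with color classes X = Fin m and Y = Fin n;
-- edges only go between X and Y, given by the adjacency relation E.
record BipGraph (m n : ℕ) : Set₁ where
  field
    E : Fin m → Fin n → Set
open BipGraph public

Vertex : ℕ → ℕ → Set
Vertex m n = Fin m ⊎ Fin n

-- A vertex-induced subgraph is represented by the graph together with the
-- sets of present vertices VX ⊆ X, VY ⊆ Y.
record Sub (m n : ℕ) : Set₁ where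
  constructor sub
  field
    graph : BipGraph m n
    VX    : Subset m
    VY    : Subset n
open Sub public

whole : ∀ {m n} → BipGraph m n → Sub m n
whole G = sub G ⊤ ⊤

delV : ∀ {m n} → Sub m n → Vertex m n → Sub m n
delV (sub G vx vy) (inj₁ x) = sub G (vx - x) vy
delV (sub G vx vy) (inj₂ y) = sub G vx (vy - y)

Pair : ℕ → ℕ → Set
Pair m n = Subset m × Subset n

Xs : ∀ {m n} → Pair m n → Subset m
Xs = proj₁

Ys : ∀ {m n} → Pair m n → Subset n
Ys = proj₂

HasUniversalVertex : ∀ {m n} → Sub m n → Set
HasUniversalVertex S =
  Σ _ (λ x → x ∈ VX S × (∀ y → y ∈ VY S → E (graph S) x y))
  ⊎ Σ _ (λ y → y ∈ VY S × (∀ x → x ∈ VX S → E (graph S) x y))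

IsBiclique : ∀ {m n} → Sub m n → Pair m n → Set
IsBiclique S B =
  (Xs B ⊆ VX S) × (Ys B ⊆ VY S) ×
  (∀ x y → x ∈ Xs B → y ∈ Ys B → E (graph S) x y)

Dominates : ∀ {m n} → Pair m n → Pair m n → Set
Dominates B B' = (Xs B' ⊆ Xs B) × (Ys B' ⊆ Ys B)

IsMaxBiclique : ∀ {m n} → Sub m n → Pair m n → Set
IsMaxBiclique S B =
  IsBiclique S B × (∀ B' → IsBiclique S B' → Dominates B' B → B' ≡ B)

_⪯_ : ∀ {m n} → Pair m n → Pair m n → Set
B ⪯ B' = Xs B ⊆ Xs B'

IsArc : ∀ {m n} → Sub m n → Pair m n → Pair m n → Set
IsArc S B B' =
  IsMaxBiclique S B × IsMaxBiclique S B' × B ⪯ B' × B ≢ B' ×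
  (∀ C → IsMaxBiclique S C → B ⪯ C → C ⪯ B' → (C ≡ B) ⊎ (C ≡ B'))

_∈B_ : ∀ {m n} → Vertex m n → Pair m n → Set
inj₁ x ∈B B = x ∈ Xs B
inj₂ y ∈B B = y ∈ Ys B

_─v_ : ∀ {m n} → Pair m n → Vertex m n → Pair m n
(U , W) ─v inj₁ x = (U - x , W)
(U , W) ─v inj₂ y = (U , W - y)

module Submission where

-- The key tool is the closure characterisation of maximal bicliques: a
-- biclique is maximal iff it contains every vertex that sees it (is adjacent
-- to its whole opposite side).  With it, a maximal biclique C of G - v lifts
-- to the maximal biclique of G obtained by adding v when v sees C; deleting
-- v from the lift gives back C.  If C lay strictly between P - v and Q - v,
-- its lift would lie strictly between P and Q (for an X-vertex v this uses
-- the closure property of P - v, C and Q once more), contradicting the arc.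
-- Whether v sees C is not decidable, but the goal (C equals one of two
-- given pairs) is, so we may still case on it.  Finally P - v ≠ Q - v since
-- deletion is injective on maximal bicliques containing v.

open import Defs
open import Data.Nat using (ℕ)
open import Data.Bool.Properties using () renaming (_≟_ to _≟ᵇ_)
open import Data.Fin using (Fin; zero; suc) renaming (_≟_ to _≟ᶠ_)
open import Data.Fin.Subset using (Subset; _∈_; _∉_; _⊆_; ⊤; _-_; _∪_; ⁅_⁆)
open import Data.Fin.Subset.Properties
  using (∈⊤; x∈⁅x⁆; x∈⁅y⁆⇒x≡y; ⊆-antisym; x∈p∪q⁻; x∈p∪q⁺; x∈p∧x≢y⇒x∈p-y; p─q⊆p)
open import Data.Product using (_×_; _,_; proj₁)
open import Data.Product.Properties using (×-≡,≡→≡) renaming (≡-dec to ×-≡-dec)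
open import Data.Sum using (_⊎_; inj₁; inj₂)
import Data.Sum as Sum
open import Data.Sum.Properties using () renaming (≡-dec to ⊎-≡-dec)
open import Data.Vec using (_∷_)
open import Data.Vec.Base using (there)
open import Data.Vec.Properties using () renaming (≡-dec to Vec-≡-dec)
open import Data.Empty using (⊥-elim)
open import Function using (_∘_)
open import Relation.Nullary using (¬_; Dec; yes; no)
open import Relation.Nullary.Decidable using (decidable-stable; ¬¬-excluded-middle; _⊎-dec_)
open import Relation.Binary.PropositionalEquality using (_≡_; _≢_; refl; sym; trans; cong; subst)

by-cases : ∀ {A Q : Set} → Dec Q → (Dec A → Q) → Q
by-cases q? k = decidable-stable q? (λ ¬q → ¬¬-excluded-middle (¬q ∘ k))

_≟ᵖ_ : ∀ {m n} (B C : Pair m n) → Dec (B ≡ C)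
_≟ᵖ_ = ×-≡-dec (Vec-≡-dec _≟ᵇ_) (Vec-≡-dec _≟ᵇ_)

_≟ᵛ_ : ∀ {m n} (u v : Vertex m n) → Dec (u ≡ v)
_≟ᵛ_ = ⊎-≡-dec _≟ᶠ_ _≟ᶠ_

x∉p-x : ∀ {n} {p : Subset n} x → x ∉ p - x
x∉p-x {p = _ ∷ _} zero    ()
x∉p-x {p = _ ∷ _} (suc x) (there x∈) = x∉p-x x x∈

module _ {n : ℕ} where

  x∈p-y⇒x≢y : ∀ {p : Subset n} {x y} → x ∈ p - y → x ≢ y
  x∈p-y⇒x≢y x∈ refl = x∉p-x _ x∈

  ⊆-restore : ∀ {p q : Subset n} {x} → p - x ⊆ q → (x ∈ p → x ∈ q) → p ⊆ q
  ⊆-restore {x = x} p-x⊆q x∈p⇒x∈q {z} z∈p with z ≟ᶠ x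
  ... | yes refl = x∈p⇒x∈q z∈p
  ... | no z≢x   = p-x⊆q (x∈p∧x≢y⇒x∈p-y z∈p z≢x)

  p⊆q⇒p-x⊆q-x : ∀ {p q : Subset n} {x} → p ⊆ q → p - x ⊆ q - x
  p⊆q⇒p-x⊆q-x {p} {x = x} p⊆q z∈ = x∈p∧x≢y⇒x∈p-y (p⊆q (p─q⊆p p ⁅ x ⁆ z∈)) (x∈p-y⇒x≢y z∈)

  ∪⁅⁆-induct : ∀ {p : Subset n} {x} (P : Fin n → Set) →
    (∀ {z} → z ∈ p → P z) → P x → ∀ {z} → z ∈ p ∪ ⁅ x ⁆ → P z
  ∪⁅⁆-induct {p} {x} P onp atx z∈ with x∈p∪q⁻ p ⁅ x ⁆ z∈
  ... | inj₁ z∈p = onp z∈p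
  ... | inj₂ z∈x = subst P (sym (x∈⁅y⁆⇒x≡y x z∈x)) atx

  x∉p⇒p-x≡p : ∀ {p : Subset n} {x} → x ∉ p → p - x ≡ p
  x∉p⇒p-x≡p {p} {x} x∉p =
    ⊆-antisym (p─q⊆p p ⁅ x ⁆) (λ z∈ → x∈p∧x≢y⇒x∈p-y z∈ λ { refl → x∉p z∈ })

  x∉p⇒p∪⁅x⁆-x≡p : ∀ {p : Subset n} {x} → x ∉ p → (p ∪ ⁅ x ⁆) - x ≡ p
  x∉p⇒p∪⁅x⁆-x≡p {p} {x} x∉p = ⊆-antisym
    (λ {z} z∈ → ∪⁅⁆-induct (λ w → w ≢ x → w ∈ p) (λ w∈ _ → w∈) (λ x≢x → ⊥-elim (x≢x refl))
                  (p─q⊆p _ ⁅ x ⁆ z∈) (x∈p-y⇒x≢y z∈))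
    (λ z∈ → x∈p∧x≢y⇒x∈p-y (x∈p∪q⁺ (inj₁ z∈)) λ { refl → x∉p z∈ })

_∈V_ : ∀ {m n} → Vertex m n → Sub m n → Set
inj₁ x ∈V S = x ∈ VX S
inj₂ y ∈V S = y ∈ VY S

Sees : ∀ {m n} → BipGraph m n → Vertex m n → Pair m n → Set
Sees G (inj₁ x) C = ∀ y → y ∈ Ys C → E G x y
Sees G (inj₂ y) C = ∀ x → x ∈ Xs C → E G x y

_+v_ : ∀ {m n} → Pair m n → Vertex m n → Pair m n
C +v inj₁ x = (Xs C ∪ ⁅ x ⁆ , Ys C)
C +v inj₂ y = (Xs C , Ys C ∪ ⁅ y ⁆)

module _ {m n : ℕ} where

  v∈B+v : ∀ v (C : Pair m n) → v ∈B (C +v v)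
  v∈B+v (inj₁ x) C = x∈p∪q⁺ (inj₂ (x∈⁅x⁆ x))
  v∈B+v (inj₂ y) C = x∈p∪q⁺ (inj₂ (x∈⁅x⁆ y))

  +v-dominates : ∀ v (C : Pair m n) → Dominates (C +v v) C
  +v-dominates (inj₁ x) C = (λ z∈ → x∈p∪q⁺ (inj₁ z∈)) , (λ w∈ → w∈)
  +v-dominates (inj₂ y) C = (λ z∈ → z∈) , (λ w∈ → x∈p∪q⁺ (inj₁ w∈))

  ≡⇒Dominates : ∀ {B C : Pair m n} → B ≡ C → Dominates B C
  ≡⇒Dominates refl = (λ z∈ → z∈) , (λ w∈ → w∈)

  ∈B-dominates : ∀ {D C : Pair m n} u → Dominates D C → u ∈B C → u ∈B D
  ∈B-dominates (inj₁ x) (hx , _) = hx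
  ∈B-dominates (inj₂ y) (_ , hy) = hy

  sees-antitone : ∀ {G : BipGraph m n} {D C : Pair m n} u → Dominates D C → Sees G u D → Sees G u C
  sees-antitone (inj₁ x) (_ , hy) s y y∈ = s y (hy y∈)
  sees-antitone (inj₂ y) (hx , _) s x x∈ = s x (hx x∈)

NothingBetween : ∀ {m n} → Sub m n → Pair m n → Pair m n → Set
NothingBetween S P Q =
  ∀ C → IsMaxBiclique S C → P ⪯ C → C ⪯ Q → (C ≡ P) ⊎ (C ≡ Q)

module Closure {m n : ℕ} {S : Sub m n} where

  +v-biclique : ∀ {C} v → IsBiclique S C → v ∈V S → Sees (graph S) v C → IsBiclique S (C +v v)
  +v-biclique (inj₁ x) (cx , cy , ce) xS s =
    ∪⁅⁆-induct (_∈ VX S) cx xS , cy ,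
    λ z y z∈ y∈ → ∪⁅⁆-induct (λ t → E (graph S) t y) (λ t∈ → ce _ y t∈ y∈) (s y y∈) z∈
  +v-biclique (inj₂ y) (cx , cy , ce) yS s =
    cx , ∪⁅⁆-induct (_∈ VY S) cy yS ,
    λ z w z∈ w∈ → ∪⁅⁆-induct (E (graph S) z) (λ t∈ → ce z _ z∈ t∈) (s z z∈) w∈

  max⇒closed : ∀ {C} v → IsMaxBiclique S C → v ∈V S → Sees (graph S) v C → v ∈B C
  max⇒closed {C} v (bC , maxC) vS s = subst (v ∈B_) C+v≡C (v∈B+v v C)
    where
    C+v≡C : C +v v ≡ C
    C+v≡C = maxC (C +v v) (+v-biclique v bC vS s) (+v-dominates v C)

  closed⇒max : ∀ {B} → IsBiclique S B →
    (∀ v → v ∈V S → Sees (graph S) v B → v ∈B B) → IsMaxBiclique S B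
  closed⇒max bB closed = bB , λ D (dx , dy , de) (hx , hy) → ×-≡,≡→≡
    ( ⊆-antisym (λ z∈ → closed (inj₁ _) (dx z∈) (λ y y∈ → de _ y z∈ (hy y∈))) hx
    , ⊆-antisym (λ w∈ → closed (inj₂ _) (dy w∈) (λ x x∈ → de x _ (hx x∈) w∈)) hy )

open Closure

module _ {m n : ℕ} where

  ─v-mono : ∀ v {B B' : Pair m n} → B ⪯ B' → (B ─v v) ⪯ (B' ─v v)
  ─v-mono (inj₁ x) = p⊆q⇒p-x⊆q-x
  ─v-mono (inj₂ y) B⪯B' = B⪯B'

  ─v-fresh : ∀ v {C : Pair m n} → ¬ v ∈B C → C ─v v ≡ C
  ─v-fresh (inj₁ x) {C} v∉C = cong (_, Ys C) (x∉p⇒p-x≡p v∉C)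
  ─v-fresh (inj₂ y) {C} v∉C = cong (Xs C ,_) (x∉p⇒p-x≡p v∉C)

  +v─v : ∀ v {C : Pair m n} → ¬ v ∈B C → (C +v v) ─v v ≡ C
  +v─v (inj₁ x) {C} v∉C = cong (_, Ys C) (x∉p⇒p∪⁅x⁆-x≡p v∉C)
  +v─v (inj₂ y) {C} v∉C = cong (Xs C ,_) (x∉p⇒p∪⁅x⁆-x≡p v∉C)

  ─v-reflects-dominates : ∀ v {P Q : Pair m n} → v ∈B Q →
    Dominates (Q ─v v) (P ─v v) → Dominates Q P
  ─v-reflects-dominates (inj₁ x) {Q = Q} x∈Q (hx , hy) =
    ⊆-restore (λ z∈ → p─q⊆p (Xs Q) ⁅ x ⁆ (hx z∈)) (λ _ → x∈Q) , hy
  ─v-reflects-dominates (inj₂ y) {Q = Q} y∈Q (hx , hy) =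
    hx , ⊆-restore (λ w∈ → p─q⊆p (Ys Q) ⁅ y ⁆ (hy w∈)) (λ _ → y∈Q)

  ─v-injective : ∀ {S : Sub m n} v {P Q : Pair m n} → v ∈B P ⊎ v ∈B Q →
    IsMaxBiclique S P → IsMaxBiclique S Q → P ─v v ≡ Q ─v v → P ≡ Q
  ─v-injective v (inj₁ v∈P) (bP , _) (_ , maxQ) e =
    maxQ _ bP (─v-reflects-dominates v v∈P (≡⇒Dominates e))
  ─v-injective v (inj₂ v∈Q) (_ , maxP) (bQ , _) e =
    sym (maxP _ bQ (─v-reflects-dominates v v∈Q (≡⇒Dominates (sym e))))

-- The graph G - v.  It agrees definitionally with delV (whole G) v once v
-- is split into its two cases, but its underlying graph is G for every v.
keepX : ∀ {m n} → Vertex m n → Subset m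
keepX (inj₁ x) = ⊤ - x
keepX (inj₂ y) = ⊤

keepY : ∀ {m n} → Vertex m n → Subset n
keepY (inj₁ x) = ⊤
keepY (inj₂ y) = ⊤ - y

_∖_ : ∀ {m n} → BipGraph m n → Vertex m n → Sub m n
G ∖ v = sub G (keepX v) (keepY v)

module Deletion {m n : ℕ} (G : BipGraph m n) where

  ∈V-whole : ∀ u → u ∈V whole G
  ∈V-whole (inj₁ x) = ∈⊤
  ∈V-whole (inj₂ y) = ∈⊤

  ∈V-∖ : ∀ {u} v → u ≢ v → u ∈V (G ∖ v)
  ∈V-∖ {inj₁ z} (inj₁ x) u≢v = x∈p∧x≢y⇒x∈p-y ∈⊤ (u≢v ∘ cong inj₁)
  ∈V-∖ {inj₁ z} (inj₂ y) u≢v = ∈⊤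
  ∈V-∖ {inj₂ w} (inj₁ x) u≢v = ∈⊤
  ∈V-∖ {inj₂ w} (inj₂ y) u≢v = x∈p∧x≢y⇒x∈p-y ∈⊤ (u≢v ∘ cong inj₂)

  ∉-∖ : ∀ v {C} → IsBiclique (G ∖ v) C → ¬ v ∈B C
  ∉-∖ (inj₁ x) (cx , _ , _) x∈C = x∉p-x x (cx x∈C)
  ∉-∖ (inj₂ y) (_ , cy , _) y∈C = x∉p-x y (cy y∈C)

  biclique-∖⇒whole : ∀ v {C} → IsBiclique (G ∖ v) C → IsBiclique (whole G) C
  biclique-∖⇒whole _ (_ , _ , ce) = (λ _ → ∈⊤) , (λ _ → ∈⊤) , ce

  lift : ∀ v (C : Pair m n) → Dec (Sees G v C) → Pair m n
  lift v C (yes _) = C +v v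
  lift v C (no _)  = C

  module _ (v : Vertex m n) {C : Pair m n} where

    lift-dominates : ∀ s → Dominates (lift v C s) C
    lift-dominates (yes _) = +v-dominates v C
    lift-dominates (no _)  = (λ z∈ → z∈) , (λ w∈ → w∈)

    lift-contains : ∀ s → Sees G v C → v ∈B lift v C s
    lift-contains (yes _)    _ = v∈B+v v C
    lift-contains (no blind) s = ⊥-elim (blind s)

    lift-sees : ∀ s → ¬ v ∈B C → v ∈B lift v C s → Sees G v C
    lift-sees (yes s) _   _   = s
    lift-sees (no _)  v∉C v∈C = ⊥-elim (v∉C v∈C)

    lift-─v : ∀ s → ¬ v ∈B C → lift v C s ─v v ≡ C
    lift-─v (yes _) = +v─v v
    lift-─v (no _)  = ─v-fresh v

    lift-max : ∀ s → IsMaxBiclique (G ∖ v) C → IsMaxBiclique (whole G) (lift v C s)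
    lift-max s mC@(bC , _) = closed⇒max (lift-biclique s) closed
      where
      lift-biclique : ∀ s → IsBiclique (whole G) (lift v C s)
      lift-biclique (yes s) = +v-biclique v (biclique-∖⇒whole v bC) (∈V-whole v) s
      lift-biclique (no _)  = biclique-∖⇒whole v bC

      closed : ∀ u → u ∈V whole G → Sees G u (lift v C s) → u ∈B lift v C s
      closed u _ su with u ≟ᵛ v
      ... | yes refl = lift-contains s (sees-antitone v (lift-dominates s) su)
      ... | no u≢v   = ∈B-dominates u (lift-dominates s)
        (max⇒closed u mC (∈V-∖ v u≢v) (sees-antitone u (lift-dominates s) su))

  -- Deleting an X-vertex x.  If P - x is maximal in G - x and x ∈ P, then x
  -- sees every biclique C of G - x above P - x: each y ∈ Y(C) sees P - x,
  -- hence lies in P by closure.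
  sees-from-below : ∀ {x P C} → IsMaxBiclique (G ∖ inj₁ x) (P ─v inj₁ x) →
    IsBiclique (whole G) P → x ∈ Xs P → (P ─v inj₁ x) ⪯ C →
    IsBiclique (G ∖ inj₁ x) C → Sees G (inj₁ x) C
  sees-from-below {x} mP' (_ , _ , pe) x∈P P'⪯C (_ , _ , ce) y y∈C =
    pe x y x∈P (max⇒closed (inj₂ y) mP' ∈⊤ (λ z z∈ → ce z y (P'⪯C z∈) y∈C))

  -- Dually, if x sees a maximal biclique C of G - x lying below Q - x with Q
  -- maximal in G, then x ∈ Q: Y(Q) ⊆ Y(C) by closure of C, so x sees Q.
  sees-to-above : ∀ {x Q C} → IsMaxBiclique (whole G) Q →
    IsMaxBiclique (G ∖ inj₁ x) C → C ⪯ (Q ─v inj₁ x) → Sees G (inj₁ x) C → x ∈ Xs Q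
  sees-to-above {x} {Q} mQ@((_ , _ , qe) , _) mC C⪯Q' s =
    max⇒closed (inj₁ x) mQ ∈⊤ (λ w w∈Q → s w
      (max⇒closed (inj₂ w) mC ∈⊤ (λ z z∈C → qe z w (p─q⊆p (Xs Q) ⁅ x ⁆ (C⪯Q' z∈C)) w∈Q)))

  lift-above : ∀ v {P C} s → IsMaxBiclique (G ∖ v) (P ─v v) → IsBiclique (whole G) P →
    IsBiclique (G ∖ v) C → (P ─v v) ⪯ C → P ⪯ lift v C s
  lift-above (inj₁ x) s mP' bP bC P'⪯C = ⊆-restore
    (proj₁ (lift-dominates (inj₁ x) s) ∘ P'⪯C)
    (λ x∈P → lift-contains (inj₁ x) s (sees-from-below mP' bP x∈P P'⪯C bC))
  lift-above (inj₂ y) s _ _ _ P'⪯C = proj₁ (lift-dominates (inj₂ y) s) ∘ P'⪯C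

  lift-below : ∀ v {Q C} s → IsMaxBiclique (whole G) Q → IsMaxBiclique (G ∖ v) C →
    C ⪯ (Q ─v v) → lift v C s ⪯ Q
  lift-below (inj₁ x) {Q} {C} s mQ mC@(bC , _) C⪯Q' = ⊆-restore
    (λ z∈ → p─q⊆p (Xs Q) ⁅ x ⁆ (C⪯Q' (subst (_ ∈_) X-lift-x≡X-C z∈)))
    (λ x∈ → sees-to-above mQ mC C⪯Q' (lift-sees (inj₁ x) s (∉-∖ (inj₁ x) bC) x∈))
    where
    X-lift-x≡X-C : Xs (lift (inj₁ x) C s) - x ≡ Xs C
    X-lift-x≡X-C = cong Xs (lift-─v (inj₁ x) s (∉-∖ (inj₁ x) bC))
  lift-below (inj₂ y) s _ (bC , _) C⪯Q' =
    C⪯Q' ∘ subst (_ ∈_) (cong Xs (lift-─v (inj₂ y) s (∉-∖ (inj₂ y) bC)))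

  -- A maximal biclique of G - v between P - v and Q - v lifts to one
  -- between P and Q, and deleting v from the lift gives it back.
  nothing-between-∖ : ∀ v {P Q} → IsMaxBiclique (G ∖ v) (P ─v v) →
    IsBiclique (whole G) P → IsMaxBiclique (whole G) Q →
    NothingBetween (whole G) P Q → NothingBetween (G ∖ v) (P ─v v) (Q ─v v)
  nothing-between-∖ v {P} {Q} mP' bP mQ between C mC@(bC , _) P'⪯C C⪯Q' =
    by-cases ((C ≟ᵖ (P ─v v)) ⊎-dec (C ≟ᵖ (Q ─v v))) λ s →
      Sum.map (undo s) (undo s)
        (between (lift v C s) (lift-max v s mC)
          (lift-above v s mP' bP bC P'⪯C) (lift-below v s mQ mC C⪯Q'))
    where
    undo : ∀ s {R} → lift v C s ≡ R → C ≡ R ─v v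
    undo s e = trans (sym (lift-─v v s (∉-∖ v bC))) (cong (_─v v) e)

  arc-∖ : ∀ v {P Q} → v ∈B P ⊎ v ∈B Q →
    IsMaxBiclique (G ∖ v) (P ─v v) → IsMaxBiclique (G ∖ v) (Q ─v v) →
    IsArc (whole G) P Q → IsArc (G ∖ v) (P ─v v) (Q ─v v)
  arc-∖ v v∈ mP' mQ' (mP , mQ , P⪯Q , P≢Q , between) =
    mP' , mQ' , ─v-mono v P⪯Q , P≢Q ∘ ─v-injective v v∈ mP mQ ,
    nothing-between-∖ v mP' (proj₁ mP) mQ between

open Deletion using (arc-∖)

-- The theorem: apply arc transfer to both orientations of the arc.  The
-- case split on v only makes G ∖ v unfold to delV (whole G) v.
lemma4 : ∀ {m n} (G : BipGraph m n) → ¬ HasUniversalVertex (whole G) →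
    (B₀ : Pair m n) (v : Vertex m n) →
    IsMaxBiclique (whole G) B₀ → v ∈B B₀ →
    IsMaxBiclique (delV (whole G) v) (B₀ ─v v) →
    ∀ (B : Pair m n) → IsMaxBiclique (whole G) B →
      IsMaxBiclique (delV (whole G) v) (B ─v v) →
      (IsArc (whole G) B B₀ → IsArc (delV (whole G) v) (B ─v v) (B₀ ─v v)) ×
      (IsArc (whole G) B₀ B → IsArc (delV (whole G) v) (B₀ ─v v) (B ─v v))
lemma4 G _ _ v@(inj₁ _) _ v∈B₀ mB₀' _ _ mB' =
  arc-∖ G v (inj₂ v∈B₀) mB' mB₀' , arc-∖ G v (inj₁ v∈B₀) mB₀' mB'
lemma4 G _ _ v@(inj₂ _) _ v∈B₀ mB₀' _ _ mB' =
  arc-∖ G v (inj₂ v∈B₀) mB' mB₀' , arc-∖ G v (inj₁ v∈B₀) mB₀' mB'
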